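{- Let $\check\phi$ and $\chi$ be quantifier-free propositional formulas over atoms of the form $p > 0$ with $p$ a closed-form expression over $\mathbf{x}$, and let $\mathbf{a}$ be the loop update. Suppose $\chi(\mathbf{x}) \equiv \bigwedge_{i=1}^k C_i$ where each clause $C_i$ contains an inequation $\mathit{expr}_i(\mathbf{x}) > 0$ such that \[ \check\phi(\mathbf{x}) \land \mathit{expr}_i(\mathbf{x}) \geq \mathit{expr}_i(\mathbf{a}(\mathbf{x})) \implies \mathit{expr}_i(\mathbf{a}(\mathbf{x})) \geq \mathit{expr}_i(\mathbf{a}^2(\mathbf{x})). \] Then the conditional acceleration technique \[ (\langle \chi,\mathbf{a} \rangle, \check\phi) \mapsto \mathbf{x}' = \mathbf{a}^n(\mathbf{x}) \land \bigwedge_{i=1}^k \left( \mathit{expr}_i(\mathbf{x}) > 0 \land \mathit{expr}_i(\mathbf{a}^{n-1}(\mathbf{x})) > 0 \right) \] is sound. If moreover $C_i \equiv \mathit{expr}_i > 0$ for all $i \in [1,k]$, then this conditional acceleration technique is exact.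
   Context: A loop $\langle \phi, \mathbf{a}\rangle$, written "while $\phi$ do $\mathbf{x} \leftarrow \mathbf{a}$", operates on a vector $\mathbf{x}=(x_1,\ldots,x_d)$ of integer variables; $\phi$ is a propositional formula over atoms $p>0$ with $p$ a closed-form expression over $\mathbf{x}$, and $\mathbf{a}$ is a vector of closed-form expressions mapping integers to integers. It induces the relation $\mathbf{x} \longrightarrow_{\langle\phi,\mathbf{a}\rangle} \mathbf{x}'$ iff $\phi(\mathbf{x}) \land \mathbf{x}' = \mathbf{a}(\mathbf{x})$. $\mathbf{a}^n$ denotes $n$-fold application of $\mathbf{a}$, $n$ is a designated variable (number of iterations) and $\mathbf{x}'$ the values after $n$ iterations. A conditional acceleration technique is a partial function mapping a pair (loop $\langle\chi,\mathbf{a}\rangle$, formula $\check\phi$ over $\mathbf{x}$) to a formula over $\mathbf{x}, n, \mathbf{x}'$. It is sound if for all pairs in its domain, all $\mathbf{x},\mathbf{x}' \in \mathbb{Z}^d$ and $n>0$: $\mathbf{x} \longrightarrow^n_{\langle \check{\phi}, \mathbf{a} \rangle} \mathbf{x}'$ together with the produced formula implies $\mathbf{x} \longrightarrow^n_{\langle \chi, \mathbf{a} \rangle} \mathbf{x}'$. It is exact if additionally $\mathbf{x} \longrightarrow^n_{\langle \chi \land \check{\phi}, \mathbf{a} \rangle} \mathbf{x}'$ implies the produced formula. -}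

module Defs where

open import Data.Nat using (ℕ; zero; suc)
open import Data.Integer using (ℤ; _<_; _≤_; 0ℤ)
open import Data.Fin using (Fin)
open import Data.Vec using (Vec; map)
open import Data.List using (List)
open import Data.List.Relation.Unary.Any using (Any)
open import Data.Product using (_×_)
open import Data.Sum using (_⊎_)
open import Relation.Nullary using (¬_)
open import Relation.Binary.PropositionalEquality using (_≡_)
open import Function using (_⇔_)

State : ℕ → Set
State d = Vec ℤ d

-- Closed-form expressions over x, modelled semantically as functions ℤ^d → ℤ.
Expr : ℕ → Set
Expr d = State d → ℤ

Update : ℕ → Set
Update d = Vec (Expr d) d

apply : ∀ {d} → Update d → State d → State d
apply a x = map (λ e → e x) a

iter : ∀ {d} → Update d → ℕ → State d → State d
iter a zero    x = x
iter a (suc n) x = iter a n (apply a x)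

data Formula (d : ℕ) : Set where
  atom : Expr d → Formula d
  neg  : Formula d → Formula d
  and  : Formula d → Formula d → Formula d
  or   : Formula d → Formula d → Formula d

⟦_⟧ : ∀ {d} → Formula d → State d → Set
⟦ atom p  ⟧ x = 0ℤ < p x
⟦ neg φ   ⟧ x = ¬ ⟦ φ ⟧ x
⟦ and φ ψ ⟧ x = ⟦ φ ⟧ x × ⟦ ψ ⟧ x
⟦ or φ ψ  ⟧ x = ⟦ φ ⟧ x ⊎ ⟦ ψ ⟧ x

Clause : ℕ → Set
Clause d = List (Formula d)

⟦_⟧ᶜ : ∀ {d} → Clause d → State d → Set
⟦ C ⟧ᶜ x = Any (λ l → ⟦ l ⟧ x) C

-- The one-step relation of the loop ⟨φ, a⟩ is  φ(x) ∧ x' = a(x);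
-- Steps φ a n x x'  is its n-fold composition  x ⟶ⁿ_⟨φ,a⟩ x'.
data Steps {d : ℕ} (φ : Formula d) (a : Update d) : ℕ → State d → State d → Set where
  done : ∀ {x} → Steps φ a zero x x
  step : ∀ {n x x'} → ⟦ φ ⟧ x → Steps φ a n (apply a x) x' → Steps φ a (suc n) x x'

-- The formula produced by the acceleration technique (for n > 0):
--   x' = aⁿ(x) ∧ ⋀ᵢ (exprᵢ(x) > 0 ∧ exprᵢ(a^{n-1}(x)) > 0)
Accel : ∀ {d k} → Update d → (Fin k → Expr d) → State d → ℕ → State d → Set
Accel {d} {k} a expr x n x' =
  (x' ≡ iter a n x) ×
  ((i : Fin k) → (0ℤ < expr i x) × (0ℤ < expr i (iter a (Data.Nat._∸_ n 1) x)))

-- Along a run of the loop, each exprᵢ evaluated on the orbit x, a(x), a²(x), … is an integer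
-- sequence that never increases again once it has decreased.  Such a sequence that is positive
-- at both ends of a segment is positive on the whole segment: at a first non-positive point it
-- has decreased, so it stays non-positive up to the end.  Hence, under the acceleration formula,
-- the atom exprᵢ > 0 of every clause Cᵢ, and thus χ, holds at every step (soundness).  When
-- Cᵢ ≡ exprᵢ > 0, running the loop under χ ∧ φ̌ makes exprᵢ positive at both endpoints (exactness).
module Submission where

open import Defs
open import Data.Nat using (ℕ; zero; suc; s≤s; z≤n)
open import Data.Nat.Properties using (≤-pred; m<n⇒m<1+n; ≤-refl)
open import Data.Integer using (ℤ; _≤_; _<_; 0ℤ)
open import Data.Integer.Properties as ℤ using (_<?_; ≮⇒≥; <⇒≤; <⇒≱)
open import Data.Fin using (Fin)
open import Data.Product using (_×_; _,_; proj₁; proj₂)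
open import Data.List.Membership.Propositional using (_∈_; lose)
open import Function using (_⇔_; _∘_; Equivalence)
open import Relation.Binary.PropositionalEquality using (_≡_; refl)
open import Relation.Nullary using (yes; no; contradiction)

open Equivalence using (to; from)

DecreaseStable : (ℕ → ℤ) → ℕ → Set
DecreaseStable f m = ∀ j → j Data.Nat.< m → f (suc j) ≤ f j → f (suc (suc j)) ≤ f (suc j)

DecreaseStable-shift : ∀ {f m} → DecreaseStable f (suc m) → DecreaseStable (f ∘ suc) m
DecreaseStable-shift stable j j<m = stable (suc j) (s≤s j<m)

decrease-persists : ∀ f m → DecreaseStable f m → f 1 ≤ f 0 → f m ≤ f 0
decrease-persists f zero    _      _      = ℤ.≤-refl
decrease-persists f (suc m) stable f₁≤f₀ =
  ℤ.≤-trans (decrease-persists (f ∘ suc) m (DecreaseStable-shift stable) (stable 0 (s≤s z≤n) f₁≤f₀))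
            f₁≤f₀

positive-throughout : ∀ f m → DecreaseStable f m → 0ℤ < f 0 → 0ℤ < f m
  → ∀ j → j Data.Nat.≤ m → 0ℤ < f j
positive-throughout f m       _      0<f₀ _    zero    _         = 0<f₀
positive-throughout f (suc m) stable 0<f₀ 0<fₘ (suc j) (s≤s j≤m) with 0ℤ <? f 1
... | yes 0<f₁ = positive-throughout (f ∘ suc) m (DecreaseStable-shift stable) 0<f₁ 0<fₘ j j≤m
... | no  0≮f₁ = contradiction fₘ≤0 (<⇒≱ 0<fₘ)
  where
  f₁≤0 : f 1 ≤ 0ℤ
  f₁≤0 = ≮⇒≥ 0≮f₁

  f₁≤f₀ : f 1 ≤ f 0
  f₁≤f₀ = ℤ.≤-trans f₁≤0 (<⇒≤ 0<f₀)

  fₘ≤0 : f (suc m) ≤ 0ℤ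
  fₘ≤0 = ℤ.≤-trans
    (decrease-persists (f ∘ suc) m (DecreaseStable-shift stable) (stable 0 (s≤s z≤n) f₁≤f₀))
    f₁≤0

module _ {d : ℕ} (a : Update d) where

  iter-suc : ∀ n x → iter a (suc n) x ≡ apply a (iter a n x)
  iter-suc zero    x = refl
  iter-suc (suc n) x = iter-suc n (apply a x)

  Steps⇒≡iter : ∀ {φ n x x'} → Steps φ a n x x' → x' ≡ iter a n x
  Steps⇒≡iter done       = refl
  Steps⇒≡iter (step _ s) = Steps⇒≡iter s

  Steps⇒guards : ∀ {φ n x x'} → Steps φ a n x x' → ∀ j → j Data.Nat.< n → ⟦ φ ⟧ (iter a j x)
  Steps⇒guards (step p _) zero    _         = p
  Steps⇒guards (step _ s) (suc j) (s≤s j<n) = Steps⇒guards s j j<n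

  Steps-reguard : ∀ {φ ψ n x x'} → Steps φ a n x x'
    → (∀ j → j Data.Nat.< n → ⟦ ψ ⟧ (iter a j x)) → Steps ψ a n x x'
  Steps-reguard done       _      = done
  Steps-reguard (step _ s) guards =
    step (guards 0 (s≤s z≤n)) (Steps-reguard s (λ j j<n → guards (suc j) (s≤s j<n)))

  orbit-decreaseStable : ∀ {φ : Formula d} (e : Expr d)
    → (∀ x → ⟦ φ ⟧ x → e (apply a x) ≤ e x → e (apply a (apply a x)) ≤ e (apply a x))
    → ∀ {m x} → (∀ j → j Data.Nat.< m → ⟦ φ ⟧ (iter a j x))
    → DecreaseStable (λ j → e (iter a j x)) m
  orbit-decreaseStable e cond {x = x} guards j j<m
    rewrite iter-suc (suc j) x | iter-suc j x = cond (iter a j x) (guards j j<m)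

theorem11 : ∀ {d k : ℕ} (χ φ̌ : Formula d) (a : Update d)
    (C : Fin k → Clause d) (expr : Fin k → Expr d)
    → (∀ x → ⟦ χ ⟧ x ⇔ ((i : Fin k) → ⟦ C i ⟧ᶜ x))
    → ((i : Fin k) → atom (expr i) ∈ C i)
    → ((i : Fin k) → ∀ x → ⟦ φ̌ ⟧ x → expr i (apply a x) ≤ expr i x
         → expr i (apply a (apply a x)) ≤ expr i (apply a x))
    → (∀ (x x' : State d) (n : ℕ) → 0 Data.Nat.< n
         → Steps φ̌ a n x x' → Accel a expr x n x' → Steps χ a n x x')
      × (((i : Fin k) → ∀ x → ⟦ C i ⟧ᶜ x ⇔ (0ℤ < expr i x))
         → ∀ (x x' : State d) (n : ℕ) → 0 Data.Nat.< n
         → Steps (and χ φ̌) a n x x' → Accel a expr x n x')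
theorem11 {d} {k} χ φ̌ a C expr χ⇔clauses atom∈C cond = sound , exact
  where
  sound : ∀ x x' n → 0 Data.Nat.< n → Steps φ̌ a n x x' → Accel a expr x n x' → Steps χ a n x x'
  sound x x' (suc m) _ run (_ , ends) = Steps-reguard a run λ j j<n →
    from (χ⇔clauses (iter a j x)) λ i → lose (atom∈C i)
      (positive-throughout (λ j → expr i (iter a j x)) m
        (orbit-decreaseStable a (expr i) (cond i) (λ j j<m → Steps⇒guards a run j (m<n⇒m<1+n j<m)))
        (proj₁ (ends i)) (proj₂ (ends i)) j (≤-pred j<n))

  exact : ((i : Fin k) → ∀ x → ⟦ C i ⟧ᶜ x ⇔ (0ℤ < expr i x))
    → ∀ x x' n → 0 Data.Nat.< n → Steps (and χ φ̌) a n x x' → Accel a expr x n x'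
  exact C⇔atom x x' (suc m) _ run = Steps⇒≡iter a run , λ i → χ⇒positive i 0 z≤n , χ⇒positive i m ≤-refl
    where
    χ⇒positive : ∀ i j → j Data.Nat.≤ m → 0ℤ < expr i (iter a j x)
    χ⇒positive i j j≤m =
      to (C⇔atom i _) (to (χ⇔clauses _) (proj₁ (Steps⇒guards a run j (s≤s j≤m))) i)
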